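{- Let $m\geq 3$, $n\geq 2$ and $0\leq l\leq n$. Then the chromatic number of the signed graph $(B(m,n),\sigma_l)$ is $2$ if $m$ is odd and $l=n$, is $2$ if $m$ is even and $l=0$, and is $3$ otherwise.
   Context: A signed graph $(G,\sigma)$ is a graph with a sign function $\sigma:E(G)\to\{1,-1\}$. A coloring in $2k+1$ signed colors is a map $c:V(G)\to\{ -k,\ldots,-1,0,1,\ldots,k\}$; a zero-free coloring in $2k$ signed colors is a map $c:V(G)\to\{ -k,\ldots,-1,1,\ldots,k\}$. A coloring is proper if $c(x)\neq\sigma(e)c(y)$ for every edge $e=xy$. The chromatic polynomial $\chi_\Sigma(\lambda)$ is the polynomial whose value at $\lambda=2k+1$ is the number of proper colorings in $2k+1$ signed colors, and the zero-free chromatic polynomial $\chi^b_\Sigma(\lambda)$ is the polynomial whose value at $\lambda=2k$ is the number of proper zero-free colorings in $2k$ signed colors. The chromatic number $\chi(\Sigma)$ is the minimum of $\{2k+1 : \chi_\Sigma(2k+1)>0\}\cup\{2r:\chi^b_\Sigma(2r)>0\}$. The book graph $B(m,n)$ has vertices $\{u,v\}\cup\{u_j^i:1\le i\le n, 1\le j\le m-2\}$ and consists of the $n$ cycles $u u_1^i\cdots u_{m-2}^i v u$ sharing the edge $uv$. Let $\sigma_0=\emptyset$ and, for $1\le l\le n$, $\sigma_l=\{uu_1^1,uu_1^2,\ldots,uu_1^l\}$ (the set of negative edges). -}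

module Defs where

open import Data.Nat as ℕ using (ℕ; zero; suc; _<ᵇ_)
open import Data.Integer as ℤ using (ℤ; +_; -_)
open import Data.Fin using (Fin; zero; suc; toℕ; combine; _↑ʳ_)
open import Data.List using (List; []; _∷_; [_]; _++_; map; concatMap; filter; length; upTo; allFin)
open import Data.List.Relation.Unary.All using (All; all?)
open import Data.Vec using (Vec; []; _∷_; lookup)
open import Data.Product using (_×_; _,_; ∃-syntax)
open import Data.Sum using (_⊎_)
open import Data.Bool using (if_then_else_)
open import Relation.Binary.PropositionalEquality using (_≡_; _≢_)
open import Relation.Nullary using (Dec; ¬?)

data Sign : Set where
  pos neg : Sign

applySign : Sign → ℤ → ℤ
applySign pos x = x
applySign neg x = - x

record SignedGraph : Set where
  field
    N     : ℕ
    edges : List (Fin N × Fin N × Sign)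
open SignedGraph public

Proper : (Σ : SignedGraph) → (Fin (N Σ) → ℤ) → Set
Proper Σ c = All (λ { (x , y , s) → c x ≢ applySign s (c y) }) (edges Σ)

proper? : (Σ : SignedGraph) → (c : Fin (N Σ) → ℤ) → Dec (Proper Σ c)
proper? Σ c = all? (λ { (x , y , s) → ¬? (c x ℤ.≟ applySign s (c y)) }) (edges Σ)

allVecs : {A : Set} → List A → (n : ℕ) → List (Vec A n)
allVecs xs zero    = [ [] ]
allVecs xs (suc n) = concatMap (λ x → map (x ∷_) (allVecs xs n)) xs

posColors : ℕ → List ℤ
posColors k = map (λ i → + suc i) (upTo k)

signedColors : ℕ → List ℤ
signedColors k = map -_ (posColors k) ++ (+ 0 ∷ posColors k)

zeroFreeColors : ℕ → List ℤ
zeroFreeColors k = map -_ (posColors k) ++ posColors k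

countProper : SignedGraph → List ℤ → ℕ
countProper Σ cols = length (filter (λ v → proper? Σ (lookup v)) (allVecs cols (N Σ)))

chiOdd : SignedGraph → ℕ → ℕ
chiOdd Σ k = countProper Σ (signedColors k)

chiZeroFree : SignedGraph → ℕ → ℕ
chiZeroFree Σ k = countProper Σ (zeroFreeColors k)

ColorableWith : SignedGraph → ℕ → Set
ColorableWith Σ d =
  (∃[ k ] (d ≡ suc (2 ℕ.* k) × 0 ℕ.< chiOdd Σ k)) ⊎
  (∃[ r ] (d ≡ 2 ℕ.* r × 0 ℕ.< chiZeroFree Σ r))

IsChromaticNumber : SignedGraph → ℕ → Set
IsChromaticNumber Σ d = ColorableWith Σ d × (∀ e → ColorableWith Σ e → d ℕ.≤ e)

-- Book graph B(m,n) with signature σ_l.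
-- Vertices: Fin (2 + n * (m - 2)); u = 0, v = 1, u^{i+1}_{j+1} = 2 + combine i j
-- (i : Fin n, j : Fin (m - 2), 0-based).
bookVertex : (m n : ℕ) → Fin n → Fin (m ℕ.∸ 2) → Fin (2 ℕ.+ n ℕ.* (m ℕ.∸ 2))
bookVertex m n i j = 2 ↑ʳ combine i j

pathEdges : {V : Set} → List V → List (V × V × Sign)
pathEdges []           = []
pathEdges (x ∷ [])     = []
pathEdges (x ∷ y ∷ xs) = (x , y , pos) ∷ pathEdges (y ∷ xs)

pageEdges : {V : Set} → V → V → Sign → List V → List (V × V × Sign)
pageEdges u v s []       = []
pageEdges u v s (x ∷ xs) = (u , x , s) ∷ pathEdges (x ∷ xs) ++ [ (lastOf x xs , v , pos) ]
  where
  lastOf : {V : Set} → V → List V → V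
  lastOf y []       = y
  lastOf y (z ∷ zs) = lastOf z zs

-- (B(m,n), σ_l): the edge u u^i_1 is negative iff i ≤ l (1-based), all others positive
book : (m n l : ℕ) → SignedGraph
book m n l = record
  { N     = 2 ℕ.+ n ℕ.* (m ℕ.∸ 2)
  ; edges = (zero , suc zero , pos) ∷
            concatMap (λ i → pageEdges zero (suc zero)
                                (if toℕ i <ᵇ l then neg else pos)
                                (map (bookVertex m n i) (allFin (m ℕ.∸ 2))))
                      (allFin n)
  }

-- Since uv is a positive edge, at least two colors are needed, and three always suffice:
-- color u with 0, v with ±1, and each page path alternately with ±1.  With the two colors
-- ±1 alone, a positive edge forces a change of color and a negative edge forces equal
-- colors, so going round a page cycle u u₁ … u_{m-2} v u determines the color of u₁ twice;
-- the two values agree exactly when the number of positive edges of the cycle is even,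
-- i.e. when the page is negative and m odd, or positive and m even.  Hence ±1 colorings
-- exist iff all pages are of the right kind: l = n for m odd, l = 0 for m even.

module Submission where

open import Defs
open import Data.Nat using (ℕ; _≤_; _%_)
open import Data.Product using (_×_)
open import Relation.Binary.PropositionalEquality using (_≡_)
open import Relation.Nullary using (¬_)

open import Data.Bool using (true; false; if_then_else_)
open import Data.Empty using (⊥-elim)
open import Data.Fin using (Fin; zero; suc; toℕ; fromℕ<; remQuot)
open import Data.Fin.Properties using (remQuot-combine; toℕ-fromℕ<; toℕ<n)
open import Data.Integer using (ℤ; -_; 0ℤ; 1ℤ; -1ℤ)
open import Data.Integer.Properties using (neg-involutive)
open import Data.List using (List; []; _∷_; [_]; map; allFin; tabulate; length)
open import Data.List.Properties using (∷-injectiveʳ; map-tabulate; length-tabulate)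
open import Data.List.Membership.Propositional using (_∈_)
open import Data.List.Membership.Propositional.Properties
  using (∈-map⁺; ∈-map⁻; ∈-concat⁺′; ∈-concat⁻′; ∈-filter⁺; ∈-filter⁻; ∈-length; ∈-++⁺ʳ)
open import Data.List.Relation.Unary.All as All using (All; []; _∷_)
import Data.List.Relation.Unary.All.Properties as AllP
open import Data.List.Relation.Unary.Any using (here; there)
open import Data.Nat using (zero; suc; _+_; _*_; _<_; _<ᵇ_; z≤n; s≤s)
import Data.Nat.Properties as ℕ
open import Data.Product using (∃-syntax; _,_; proj₁; proj₂)
open import Data.Sum using (_⊎_; inj₁; inj₂)
open import Data.Unit using (tt)
open import Data.Vec as Vec using (Vec; lookup)
open import Data.Vec.Properties using (lookup∘tabulate)
open import Function using (_∘_)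
open import Relation.Binary.PropositionalEquality using (_≢_; refl; sym; trans; cong; subst; module ≡-Reasoning)

ProperlyColorable : SignedGraph → List ℤ → Set
ProperlyColorable Σ cols = ∃[ c ] ((∀ x → c x ∈ cols) × Proper Σ c)

ProperEdge : {V : Set} → (V → ℤ) → V × V × Sign → Set
ProperEdge c (x , y , s) = c x ≢ applySign s (c y)

Proper-cong : ∀ Σ {c d : Fin (N Σ) → ℤ} → (∀ x → c x ≡ d x) → Proper Σ c → Proper Σ d
Proper-cong Σ c≗d = All.map λ { {x , y , s} c-ok d-bad →
  c-ok (trans (c≗d x) (trans d-bad (cong (applySign s) (sym (c≗d y))))) }

allVecs-sound : ∀ {A : Set} (xs : List A) n {v : Vec A n} →
                v ∈ allVecs xs n → ∀ i → lookup v i ∈ xs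
allVecs-sound xs (suc n) v∈ i with ∈-concat⁻′ (map _ xs) v∈
... | _ , v∈ys , ys∈ with ∈-map⁻ _ ys∈
... | x , x∈xs , refl with ∈-map⁻ _ v∈ys | i
... | w , w∈ , refl | zero  = x∈xs
... | w , w∈ , refl | suc j = allVecs-sound xs n w∈ j

allVecs-complete : ∀ {A : Set} (xs : List A) n (v : Vec A n) →
                   (∀ i → lookup v i ∈ xs) → v ∈ allVecs xs n
allVecs-complete xs zero    Vec.[]      _  = here refl
allVecs-complete xs (suc n) (x Vec.∷ w) v∈ =
  ∈-concat⁺′ (∈-map⁺ (x Vec.∷_) (allVecs-complete xs n w (v∈ ∘ suc))) (∈-map⁺ _ (v∈ zero))

length>0⇒∈ : ∀ {A : Set} {ys : List A} → 0 < length ys → ∃[ y ] y ∈ ys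
length>0⇒∈ {ys = y ∷ _} _ = y , here refl

countProper>0⇒colorable : ∀ Σ cols → 0 < countProper Σ cols → ProperlyColorable Σ cols
countProper>0⇒colorable Σ cols count>0 with length>0⇒∈ count>0
... | v , v∈ with ∈-filter⁻ (λ v → proper? Σ (lookup v)) {xs = allVecs cols (N Σ)} v∈
... | v∈allVecs , proper = lookup v , allVecs-sound cols (N Σ) v∈allVecs , proper

colorable⇒countProper>0 : ∀ Σ cols → ProperlyColorable Σ cols → 0 < countProper Σ cols
colorable⇒countProper>0 Σ cols (c , c∈cols , proper) =
  ∈-length (∈-filter⁺ (λ v → proper? Σ (lookup v)) v∈allVecs
             (Proper-cong Σ (sym ∘ lookup∘tabulate c) proper))
  where
  v∈allVecs : Vec.tabulate c ∈ allVecs cols (N Σ)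
  v∈allVecs = allVecs-complete cols (N Σ) (Vec.tabulate c)
                (λ x → subst (_∈ cols) (sym (lookup∘tabulate c x)) (c∈cols x))

0∈signedColors : ∀ k → 0ℤ ∈ signedColors k
0∈signedColors k = ∈-++⁺ʳ (map -_ (posColors k)) (here refl)

colorableWith-odd : ∀ Σ k → ProperlyColorable Σ (signedColors k) → ColorableWith Σ (suc (2 * k))
colorableWith-odd Σ k colorable = inj₁ (k , refl , colorable⇒countProper>0 Σ _ colorable)

colorableWith-even : ∀ Σ r → ProperlyColorable Σ (zeroFreeColors r) → ColorableWith Σ (2 * r)
colorableWith-even Σ r colorable = inj₂ (r , refl , colorable⇒countProper>0 Σ _ colorable)

-- A positive edge xy excludes the color sets {0} (c x = c y = 0) and ∅ (x has no color).
colorableWith-2⊎≥3 : ∀ Σ {x y} → (x , y , pos) ∈ edges Σ → ∀ {e} → ColorableWith Σ e →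
                   (e ≡ 2 × ProperlyColorable Σ (zeroFreeColors 1)) ⊎ 3 ≤ e
colorableWith-2⊎≥3 Σ {x} {y} xy∈ (inj₁ (zero , refl , count>0))
  with countProper>0⇒colorable Σ _ count>0
... | c , c∈ , proper with c∈ x | c∈ y | All.lookup proper xy∈
... | here cx≡0 | here cy≡0 | cx≢cy = ⊥-elim (cx≢cy (trans cx≡0 (sym cy≡0)))
colorableWith-2⊎≥3 Σ xy∈ (inj₁ (suc k , refl , _)) = inj₂ (s≤s (ℕ.*-monoʳ-≤ 2 (s≤s z≤n)))
colorableWith-2⊎≥3 Σ {x} xy∈ (inj₂ (zero , refl , count>0))
  with countProper>0⇒colorable Σ _ count>0
... | c , c∈ , _ with c∈ x
... | ()
colorableWith-2⊎≥3 Σ xy∈ (inj₂ (suc zero , refl , count>0)) =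
  inj₁ (refl , countProper>0⇒colorable Σ _ count>0)
colorableWith-2⊎≥3 Σ xy∈ (inj₂ (suc (suc r) , refl , _)) =
  inj₂ (ℕ.≤-trans (ℕ.n≤1+n 3) (ℕ.*-monoʳ-≤ 2 {2} (s≤s (s≤s z≤n))))

chromatic-2 : ∀ Σ {x y} → (x , y , pos) ∈ edges Σ →
              ProperlyColorable Σ (zeroFreeColors 1) → IsChromaticNumber Σ 2
chromatic-2 Σ xy∈ colorable = colorableWith-even Σ 1 colorable , 2≤
  where
  2≤ : ∀ e → ColorableWith Σ e → 2 ≤ e
  2≤ e colorableWith with colorableWith-2⊎≥3 Σ xy∈ colorableWith
  ... | inj₁ (refl , _) = ℕ.≤-refl
  ... | inj₂ 3≤e        = ℕ.≤-trans (ℕ.n≤1+n 2) 3≤e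

chromatic-3 : ∀ Σ {x y} → (x , y , pos) ∈ edges Σ →
              ProperlyColorable Σ (signedColors 1) → ¬ ProperlyColorable Σ (zeroFreeColors 1) →
              IsChromaticNumber Σ 3
chromatic-3 Σ xy∈ colorable not-2-colorable = colorableWith-odd Σ 1 colorable , 3≤
  where
  3≤ : ∀ e → ColorableWith Σ e → 3 ≤ e
  3≤ e colorableWith with colorableWith-2⊎≥3 Σ xy∈ colorableWith
  ... | inj₁ (_ , 2-colorable) = ⊥-elim (not-2-colorable 2-colorable)
  ... | inj₂ 3≤e               = 3≤e

IsUnit : ℤ → Set
IsUnit z = z ≡ 1ℤ ⊎ z ≡ -1ℤ

unit-neg : ∀ {z} → IsUnit z → IsUnit (- z)
unit-neg (inj₁ refl) = inj₂ refl
unit-neg (inj₂ refl) = inj₁ refl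

unit-applySign : ∀ s {z} → IsUnit z → IsUnit (applySign s z)
unit-applySign pos u = u
unit-applySign neg u = unit-neg u

unit≢neg : ∀ {z} → IsUnit z → z ≢ - z
unit≢neg (inj₁ refl) ()
unit≢neg (inj₂ refl) ()

0≢unit : ∀ {z} → IsUnit z → 0ℤ ≢ z
0≢unit (inj₁ refl) ()
0≢unit (inj₂ refl) ()

unit-≢⇒neg : ∀ {x y} → IsUnit x → IsUnit y → x ≢ y → y ≡ - x
unit-≢⇒neg (inj₁ refl) (inj₁ refl) x≢y = ⊥-elim (x≢y refl)
unit-≢⇒neg (inj₁ refl) (inj₂ refl) _   = refl
unit-≢⇒neg (inj₂ refl) (inj₁ refl) _   = refl
unit-≢⇒neg (inj₂ refl) (inj₂ refl) x≢y = ⊥-elim (x≢y refl)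

unit⇒zeroFree : ∀ {z} → IsUnit z → z ∈ zeroFreeColors 1
unit⇒zeroFree (inj₁ refl) = there (here refl)
unit⇒zeroFree (inj₂ refl) = here refl

zeroFree⇒unit : ∀ {z} → z ∈ zeroFreeColors 1 → IsUnit z
zeroFree⇒unit (here refl)         = inj₂ refl
zeroFree⇒unit (there (here refl)) = inj₁ refl

unit⇒signed : ∀ {z} → IsUnit z → z ∈ signedColors 1
unit⇒signed (inj₁ refl) = there (there (here refl))
unit⇒signed (inj₂ refl) = here refl

sign-negating-unit : ∀ {s x} → IsUnit x → applySign s x ≡ - x → s ≡ neg
sign-negating-unit {pos} u x≡-x = ⊥-elim (unit≢neg u x≡-x)
sign-negating-unit {neg} _ _    = refl

sign-fixing-unit : ∀ {s x} → IsUnit x → applySign s x ≡ x → s ≡ pos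
sign-fixing-unit {pos} _ _     = refl
sign-fixing-unit {neg} u -x≡x = ⊥-elim (unit≢neg u (sym -x≡x))

alternate : ℕ → ℤ → ℤ
alternate zero    z = z
alternate (suc n) z = alternate n (- z)

unit-alternate : ∀ n {z} → IsUnit z → IsUnit (alternate n z)
unit-alternate zero    u = u
unit-alternate (suc n) u = unit-alternate n (unit-neg u)

alternate-even : ∀ n z → n % 2 ≡ 0 → alternate n z ≡ z
alternate-odd  : ∀ n z → n % 2 ≡ 1 → alternate n z ≡ - z
alternate-even zero          z _  = refl
alternate-even (suc (suc n)) z ev = trans (alternate-even n (- - z) ev) (neg-involutive z)
alternate-odd  (suc zero)    z _  = refl
alternate-odd  (suc (suc n)) z od = trans (alternate-odd n (- - z) od) (cong -_ (neg-involutive z))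

parity : ∀ n → (n % 2 ≡ 0 × suc n % 2 ≡ 1) ⊎ (n % 2 ≡ 1 × suc n % 2 ≡ 0)
parity zero          = inj₁ (refl , refl)
parity (suc zero)    = inj₂ (refl , refl)
parity (suc (suc n)) = parity n

pathTo : {V : Set} → V → List V → V → List (V × V × Sign)
pathTo x []       b = [ (x , b , pos) ]
pathTo x (y ∷ ys) b = (x , y , pos) ∷ pathTo y ys b

pageEdges-∷ : ∀ {V : Set} (u v : V) s x xs → pageEdges u v s (x ∷ xs) ≡ (u , x , s) ∷ pathTo x xs v
pageEdges-∷ u v s x []       = refl
pageEdges-∷ u v s x (y ∷ ys) = cong ((u , x , s) ∷_) (cong ((x , y , pos) ∷_)
                                 (∷-injectiveʳ (pageEdges-∷ u v s y ys)))

module _ {V : Set} (c : V → ℤ) where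

  pathTo-alternating : ∀ k (f : Fin (suc k) → V) {z} b → IsUnit z →
                       (∀ j → c (f j) ≡ alternate (toℕ j) z) → c b ≢ alternate k z →
                       All (ProperEdge c) (pathTo (f zero) (tabulate (f ∘ suc)) b)
  pathTo-alternating zero    f b u cf cb≢ = (λ eq → cb≢ (trans (sym eq) (cf zero))) ∷ []
  pathTo-alternating (suc k) f b u cf cb≢ =
    (λ eq → unit≢neg u (trans (sym (cf zero)) (trans eq (cf (suc zero)))))
    ∷ pathTo-alternating k (f ∘ suc) b (unit-neg u) (cf ∘ suc) cb≢

  module _ (unit : ∀ v → IsUnit (c v)) where

    pathTo-forces : ∀ x xs b → All (ProperEdge c) (pathTo x xs b) →
                    c b ≡ - alternate (length xs) (c x)
    pathTo-forces x []       b (x≢b ∷ []) = unit-≢⇒neg (unit x) (unit b) x≢b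
    pathTo-forces x (y ∷ ys) b (x≢y ∷ path) =
      trans (pathTo-forces y ys b path)
            (cong (-_ ∘ alternate (length ys)) (unit-≢⇒neg (unit x) (unit y) x≢y))

    -- Going round the cycle u x x₁ … v u the color of x is determined twice.
    page-forces : ∀ u v s x xs → c u ≢ c v → All (ProperEdge c) ((u , x , s) ∷ pathTo x xs v) →
                  applySign s (c x) ≡ - alternate (length xs) (c x)
    page-forces u v s x xs u≢v (u≢sx ∷ path) = begin
      applySign s (c x)               ≡⟨ unit-≢⇒neg (unit u) (unit-applySign s (unit x)) u≢sx ⟩
      - c u                           ≡⟨ sym (unit-≢⇒neg (unit u) (unit v) u≢v) ⟩
      c v                             ≡⟨ pathTo-forces x xs v path ⟩
      - alternate (length xs) (c x)   ∎
      where open ≡-Reasoning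

pageSign : ∀ {n} → ℕ → Fin n → Sign
pageSign l i = if toℕ i <ᵇ l then neg else pos

<⇒pageSign≡neg : ∀ {n l} (i : Fin n) → toℕ i < l → pageSign l i ≡ neg
<⇒pageSign≡neg {l = l} i i<l with toℕ i <ᵇ l | ℕ.<⇒<ᵇ i<l
... | true | _ = refl

pageSign≡neg⇒< : ∀ {n} l (i : Fin n) → pageSign l i ≡ neg → toℕ i < l
pageSign≡neg⇒< l i neg≡ with toℕ i <ᵇ l | ℕ.<ᵇ⇒< (toℕ i) l
pageSign≡neg⇒< l i neg≡ | true  | i<l = i<l tt
pageSign≡neg⇒< l i ()   | false | _

-- The book B(3 + k, n): every page has k + 1 inner vertices.
module _ (k n : ℕ) where

  Vertex : Set
  Vertex = Fin (2 + n * suc k)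

  inner : Fin n → Fin (suc k) → Vertex
  inner = bookVertex (3 + k) n

  page : ℕ → Fin n → List (Vertex × Vertex × Sign)
  page l i =
    (zero , inner i zero , pageSign l i) ∷ pathTo (inner i zero) (tabulate (inner i ∘ suc)) (suc zero)

  pageEdges≡page : ∀ l i →
    pageEdges zero (suc zero) (pageSign l i) (map (inner i) (allFin (suc k))) ≡ page l i
  pageEdges≡page l i =
    trans (cong (pageEdges zero (suc zero) (pageSign l i)) (map-tabulate (λ j → j) (inner i)))
          (pageEdges-∷ zero (suc zero) (pageSign l i) (inner i zero) (tabulate (inner i ∘ suc)))

  Proper-book⁺ : ∀ l c → c zero ≢ c (suc zero) → (∀ i → All (ProperEdge c) (page l i)) →
                 Proper (book (3 + k) n l) c
  Proper-book⁺ l c u≢v pages =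
    u≢v ∷ AllP.concat⁺ (AllP.map⁺ (AllP.tabulate⁺ λ i →
            subst (All (ProperEdge c)) (sym (pageEdges≡page l i)) (pages i)))

  Proper-book⁻ : ∀ l c → Proper (book (3 + k) n l) c →
                 c zero ≢ c (suc zero) × (∀ i → All (ProperEdge c) (page l i))
  Proper-book⁻ l c (u≢v ∷ pages) = u≢v , λ i →
    subst (All (ProperEdge c)) (pageEdges≡page l i)
          (AllP.tabulate⁻ (AllP.map⁻ (AllP.concat⁻ {xss = map _ (allFin n)} pages)) i)

  bookColoring : ℤ → ℤ → ℤ → Vertex → ℤ
  bookColoring a b z zero          = a
  bookColoring a b z (suc zero)    = b
  bookColoring a b z (suc (suc y)) = alternate (toℕ (proj₂ (remQuot {n} (suc k) y))) z

  bookColoring-inner : ∀ a b z i j → bookColoring a b z (inner i j) ≡ alternate (toℕ j) z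
  bookColoring-inner a b z i j = cong (λ p → alternate (toℕ (proj₂ p)) z) (remQuot-combine i j)

  bookColoring-∈ : ∀ {cols a b z} → a ∈ cols → b ∈ cols → (∀ j → alternate j z ∈ cols) →
                   ∀ x → bookColoring a b z x ∈ cols
  bookColoring-∈ a∈ b∈ alt∈ zero          = a∈
  bookColoring-∈ a∈ b∈ alt∈ (suc zero)    = b∈
  bookColoring-∈ a∈ b∈ alt∈ (suc (suc y)) = alt∈ (toℕ (proj₂ (remQuot {n} (suc k) y)))

  bookColoring-proper : ∀ l {a b z} → a ≢ b → IsUnit z → (∀ i → a ≢ applySign (pageSign l i) z) →
                        b ≢ alternate k z → Proper (book (3 + k) n l) (bookColoring a b z)
  bookColoring-proper l {a} {b} {z} a≢b u a≢first b≢last =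
    Proper-book⁺ l c a≢b λ i →
      subst (λ w → a ≢ applySign (pageSign l i) w) (sym (bookColoring-inner a b z i zero)) (a≢first i)
      ∷ pathTo-alternating c k (inner i) (suc zero) u (bookColoring-inner a b z i) b≢last
    where c = bookColoring a b z

  unit-colorable-forces : ∀ l → ProperlyColorable (book (3 + k) n l) (zeroFreeColors 1) →
                          ∀ i → ∃[ x ] (IsUnit x × applySign (pageSign l i) x ≡ - alternate k x)
  unit-colorable-forces l (c , c∈ , proper) i =
    c (inner i zero) , unit (inner i zero) ,
    subst (λ len → applySign (pageSign l i) (c (inner i zero)) ≡ - alternate len (c (inner i zero)))
          (length-tabulate (inner i ∘ suc))
          (page-forces c unit zero (suc zero) (pageSign l i) (inner i zero) _
             (proj₁ (Proper-book⁻ l c proper)) (proj₂ (Proper-book⁻ l c proper) i))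
    where
    unit : ∀ x → IsUnit (c x)
    unit = zeroFree⇒unit ∘ c∈

  book-3-colorable : ∀ l → ProperlyColorable (book (3 + k) n l) (signedColors 1)
  book-3-colorable l =
    bookColoring 0ℤ b 1ℤ ,
    bookColoring-∈ (0∈signedColors 1) (unit⇒signed b-unit) (λ j → unit⇒signed (unit-alternate j 1-unit)) ,
    bookColoring-proper l (0≢unit b-unit) 1-unit
      (λ i → 0≢unit (unit-applySign (pageSign l i) 1-unit))
      (λ b≡last → unit≢neg (unit-alternate k 1-unit) (sym b≡last))
    where
    1-unit : IsUnit 1ℤ
    1-unit = inj₁ refl
    b = - alternate k 1ℤ
    b-unit : IsUnit b
    b-unit = unit-neg (unit-alternate k 1-unit)

  book-2-colorable-all-negative : k % 2 ≡ 0 → ProperlyColorable (book (3 + k) n n) (zeroFreeColors 1)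
  book-2-colorable-all-negative k-even =
    bookColoring 1ℤ -1ℤ 1ℤ ,
    bookColoring-∈ (unit⇒zeroFree (inj₁ refl)) (unit⇒zeroFree (inj₂ refl))
                   (λ j → unit⇒zeroFree (unit-alternate j (inj₁ refl))) ,
    bookColoring-proper n (λ ()) (inj₁ refl)
      (λ i → subst (λ s → 1ℤ ≢ applySign s 1ℤ) (sym (<⇒pageSign≡neg i (toℕ<n i))) (λ ()))
      (subst (-1ℤ ≢_) (sym (alternate-even k 1ℤ k-even)) (λ ()))

  book-2-colorable-all-positive : k % 2 ≡ 1 → ProperlyColorable (book (3 + k) n 0) (zeroFreeColors 1)
  book-2-colorable-all-positive k-odd =
    bookColoring 1ℤ -1ℤ -1ℤ ,
    bookColoring-∈ (unit⇒zeroFree (inj₁ refl)) (unit⇒zeroFree (inj₂ refl))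
                   (λ j → unit⇒zeroFree (unit-alternate j (inj₂ refl))) ,
    bookColoring-proper 0 (λ ()) (inj₂ refl) (λ i → λ ())
      (subst (-1ℤ ≢_) (sym (alternate-odd k -1ℤ k-odd)) (λ ()))

  book-not-2-colorable-positive-page : ∀ {l} → k % 2 ≡ 0 → l < n →
                                       ¬ ProperlyColorable (book (3 + k) n l) (zeroFreeColors 1)
  book-not-2-colorable-positive-page {l} k-even l<n colorable =
    ℕ.n≮n l (subst (_< l) (toℕ-fromℕ< l<n) (pageSign≡neg⇒< l i page-negative))
    where
    i = fromℕ< l<n
    forced = unit-colorable-forces l colorable i
    x = proj₁ forced
    page-negative : pageSign l i ≡ neg
    page-negative = sign-negating-unit (proj₁ (proj₂ forced))
                      (trans (proj₂ (proj₂ forced)) (cong -_ (alternate-even k x k-even)))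

  book-not-2-colorable-negative-page : ∀ {l} → k % 2 ≡ 1 → 0 < l → l ≤ n →
                                       ¬ ProperlyColorable (book (3 + k) n l) (zeroFreeColors 1)
  book-not-2-colorable-negative-page {l} k-odd 0<l l≤n colorable =
    neg≢pos (trans (sym page-negative) page-positive)
    where
    neg≢pos : neg ≢ pos
    neg≢pos ()
    i = fromℕ< (ℕ.≤-trans 0<l l≤n)
    forced = unit-colorable-forces l colorable i
    x = proj₁ forced
    page-negative : pageSign l i ≡ neg
    page-negative = <⇒pageSign≡neg i (subst (_< l) (sym (toℕ-fromℕ< _)) 0<l)
    page-positive : pageSign l i ≡ pos
    page-positive = sign-fixing-unit (proj₁ (proj₂ forced))
                      (trans (proj₂ (proj₂ forced))
                             (trans (cong -_ (alternate-odd k x k-odd)) (neg-involutive x)))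

theorem2p2 : (m n l : ℕ) → 3 ≤ m → 2 ≤ n → l ≤ n →
    ((m % 2 ≡ 1 × l ≡ n) → IsChromaticNumber (book m n l) 2) ×
    ((m % 2 ≡ 0 × l ≡ 0) → IsChromaticNumber (book m n l) 2) ×
    (¬ (m % 2 ≡ 1 × l ≡ n) → ¬ (m % 2 ≡ 0 × l ≡ 0) → IsChromaticNumber (book m n l) 3)
theorem2p2 (suc zero)          _ _ (s≤s ())
theorem2p2 (suc (suc zero))    _ _ (s≤s (s≤s ()))
theorem2p2 (suc (suc (suc k))) n l _ _ l≤n with parity k
... | inj₁ (k-even , m-odd) =
      (λ { (_ , refl) → chromatic-2 _ (here refl) (book-2-colorable-all-negative k n k-even) })
    , (λ { (m-even , _) → ⊥-elim (ℕ.0≢1+n (trans (sym m-even) m-odd)) })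
    , λ not-all-negative _ → chromatic-3 _ (here refl) (book-3-colorable k n l)
        (book-not-2-colorable-positive-page k n k-even
          (ℕ.≤∧≢⇒< l≤n (λ l≡n → not-all-negative (m-odd , l≡n))))
... | inj₂ (k-odd , m-even) =
      (λ { (m-odd , _) → ⊥-elim (ℕ.0≢1+n (trans (sym m-even) m-odd)) })
    , (λ { (_ , refl) → chromatic-2 _ (here refl) (book-2-colorable-all-positive k n k-odd) })
    , λ _ not-all-positive → chromatic-3 _ (here refl) (book-3-colorable k n l)
        (book-not-2-colorable-negative-page k n k-odd
          (ℕ.n≢0⇒n>0 (λ l≡0 → not-all-positive (m-even , l≡0))) l≤n)
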